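{- Let $r,n\ge1$ be integers, $c,d\in\mathbb{Z}$, and let $D=n^r/|\Lambda_{fin}|$. Then \[D=\begin{cases}\left(\dfrac{n}{\gcd(c,n)}\right)^r & \text{if } d\equiv0\pmod n,\\[2ex] \left(\dfrac{n}{\gcd(d,n)}\right)^{r-1}\cdot\dfrac{n}{\gcd((r-1)d,n)} & \text{if } c\equiv 0\pmod n.\end{cases}\]
   Context: $B_{c,d}$ is the $r\times r$ matrix with diagonal entries $c$ and off-diagonal entries $d$, and $\Lambda_{fin}=\{\boldsymbol{x}\in(\mathbb{Z}/n\mathbb{Z})^r:B_{c,d}\boldsymbol{x}\equiv\boldsymbol{0}\pmod n\}$. The quantity $D$ is the dimension of the space $\mathfrak{W}$ of Whittaker functions on a principal series representation of the $n$-fold metaplectic cover of $GL_r(F)$ ($F$ a nonarchimedean local field containing $\mu_{2n}$) attached to the bilinear form with matrix $B_{c,d}$. -}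

module Defs where

open import Data.Nat as ℕ using (ℕ; zero; suc; NonZero)
open import Data.Nat.GCD using (gcd; gcd[m,n]≢0)
open import Data.Integer as ℤ using (ℤ; +_; ∣_∣)
open import Data.Integer.Divisibility using (_∣_)
open import Data.Integer.Properties using (*-zeroʳ)
open import Data.Fin using (Fin; toℕ; _≟_)
import Data.Fin as Fin
import Data.Fin.Properties as FinP
open import Data.Vec using (Vec; []; _∷_; lookup; replicate)
open import Data.List using (List; _∷_; []; length; filter; map; concatMap; allFin)
open import Data.List.Properties using (filter-accept)
open import Data.Bool using (if_then_else_)
open import Data.Product using (∃; _,_)
open import Relation.Nullary using (Dec; yes; no; does)
open import Relation.Binary.PropositionalEquality using (_≡_; refl; cong; cong₂; trans)
open import Data.Sum using (inj₂)
import Data.Nat.Divisibility as ℕD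

B : ∀ {r} → ℤ → ℤ → Fin r → Fin r → ℤ
B c d i j = if does (i ≟ j) then c else d

Σℤ : ∀ {r} → (Fin r → ℤ) → ℤ
Σℤ {zero} f = + 0
Σℤ {suc r} f = f Fin.zero ℤ.+ Σℤ (λ j → f (Fin.suc j))

-- i-th entry of B_{c,d} x, where x ∈ (ℤ/nℤ)^r is represented by its
-- canonical residues in {0,…,n-1}.
Bx : ∀ {n r} → ℤ → ℤ → Vec (Fin n) r → Fin r → ℤ
Bx c d x i = Σℤ (λ j → B c d i j ℤ.* + toℕ (lookup x j))

InΛ : (n : ℕ) {r : ℕ} → ℤ → ℤ → Vec (Fin n) r → Set
InΛ n c d x = ∀ i → (+ n) ∣ Bx c d x i

InΛ? : (n : ℕ) {r : ℕ} (c d : ℤ) (x : Vec (Fin n) r) → Dec (InΛ n c d x)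
InΛ? n c d x = FinP.all? (λ i → n ℕD.∣? ∣ Bx c d x i ∣)

allVecs : (n r : ℕ) → List (Vec (Fin n) r)
allVecs n zero = [] ∷ []
allVecs n (suc r) = concatMap (λ a → map (a ∷_) (allVecs n r)) (allFin n)

cardΛ : (n r : ℕ) → ℤ → ℤ → ℕ
cardΛ n r c d = length (filter (InΛ? n c d) (allVecs n r))

-- Helper facts: |Λ_fin| ≥ 1 (the zero vector lies in Λ_fin), so that
-- D = n^r / |Λ_fin| is a well-defined (exact) natural-number division.
Σ-zero : ∀ {r} (f : Fin r → ℤ) → (∀ j → f j ≡ + 0) → Σℤ f ≡ + 0
Σ-zero {zero} f h = refl
Σ-zero {suc r} f h = cong₂ ℤ._+_ (h Fin.zero) (Σ-zero (λ j → f (Fin.suc j)) (λ j → h (Fin.suc j)))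

lookup-rep : ∀ {k r} (j : Fin r) → lookup (replicate r (Fin.zero {k})) j ≡ Fin.zero
lookup-rep Fin.zero = refl
lookup-rep (Fin.suc j) = lookup-rep j

zeroIn : ∀ k {r} c d → InΛ (suc k) {r} c d (replicate r Fin.zero)
zeroIn k {r} c d i rewrite Σ-zero (λ j → B c d i j ℤ.* + toℕ (lookup (replicate r (Fin.zero {k})) j))
                         (λ j → trans (cong (λ z → B c d i j ℤ.* + toℕ z) (lookup-rep j)) (*-zeroʳ (B c d i j)))
  = ℕD._∣0 (suc k)

allVecs-head : ∀ k r → ∃ λ rest → allVecs (suc k) r ≡ replicate r Fin.zero ∷ rest
allVecs-head k zero = _ , refl
allVecs-head k (suc r) with allVecs (suc k) r | allVecs-head k r
... | _ | rest , refl = _ , refl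

cardΛ-nonZero : ∀ n r c d .{{_ : NonZero n}} → NonZero (cardΛ n r c d)
cardΛ-nonZero (suc k) r c d with allVecs-head k r
... | rest , eq rewrite eq | filter-accept (InΛ? (suc k) c d) {x = replicate r Fin.zero} {xs = rest} (zeroIn k c d) = _

Dim : (n r : ℕ) .{{_ : NonZero n}} → ℤ → ℤ → ℕ
Dim n r c d = ((n ℕ.^ r) ℕ./ cardΛ n r c d) {{cardΛ-nonZero n r c d}}

gcd-nonZero : ∀ m n .{{_ : NonZero n}} → NonZero (gcd m n)
gcd-nonZero m (suc n) = ℕ.≢-nonZero (gcd[m,n]≢0 m (suc n) (inj₂ λ ()))

_/gcd_ : (n : ℕ) .{{_ : NonZero n}} → ℤ → ℕ
n /gcd a = (n ℕ./ gcd ∣ a ∣ n) {{gcd-nonZero ∣ a ∣ n}}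

-- Row i of B_{c,d} x is c xᵢ + d (Σ x − xᵢ). If n ∣ d the rows decouple into the
-- independent conditions n ∣ c xᵢ; if n ∣ c they say n ∣ d (Σ x − xᵢ) for all i, which is
-- equivalent to n ∣ (r−1) d x₀ together with n ∣ d (xⱼ − x₀) for j ≥ 1. For fixed e and a,
-- n ∣ e (y − a) means y ≡ a modulo n / gcd(e, n), which has exactly gcd(e, n) solutions
-- y ∈ ℤ/nℤ. Counting coordinate by coordinate gives |Λ_fin| = gcd(c, n)^r in the first case
-- and gcd((r−1)d, n) · gcd(d, n)^(r−1) in the second, and D = n^r / |Λ_fin| follows from
-- n = (n / gcd(e, n)) · gcd(e, n).
module Submission where

open import Defs
open import Data.Nat.Base as ℕ using (ℕ; zero; suc; NonZero; _<_; _≤_; z≤n; s≤s; z<s; _%_; _/_)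
import Data.Nat.Properties as ℕₚ
open import Data.Nat.GCD using (gcd)
open import Data.Integer.Base as ℤ using (ℤ; ∣_∣)
import Data.Integer.Properties as ℤₚ
open import Data.Fin.Base as Fin using (Fin; toℕ)
open import Data.Vec.Base using (Vec; []; _∷_; lookup)
open import Data.List.Base using (List; []; _∷_; _++_; length; filter; map; concatMap; tabulate; allFin)
open import Data.Nat.ListAction using (sum)
open import Data.List.Properties using (filter-++; length-++; filter-accept; filter-none; map-cong)
import Data.List.Relation.Unary.All as All
open import Data.Bool.Base using (if_then_else_)
open import Data.Product.Base using (_×_; _,_; proj₁; proj₂)
open import Data.Sum.Base using (inj₁; inj₂)
open import Data.Empty using (⊥-elim)
open import Function.Base using (id; _∘_)
open import Function.Bundles using (_⇔_; mk⇔; Equivalence)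
open import Function.Construct.Identity using (⇔-id)
open import Function.Properties.Equivalence using () renaming (trans to ⇔-trans)
open import Relation.Nullary using (¬_; yes; no; does)
open import Relation.Unary using (Decidable)
open import Relation.Binary.PropositionalEquality
  using (_≡_; refl; sym; trans; cong; cong₂; subst; subst₂; module ≡-Reasoning)

open Equivalence using (to; from)

∀-⇔ : ∀ {I : Set} {P Q : I → Set} → (∀ i → P i ⇔ Q i) → (∀ i → P i) ⇔ (∀ i → Q i)
∀-⇔ P⇔Q = mk⇔ (λ p i → to (P⇔Q i) (p i)) (λ q i → from (P⇔Q i) (q i))

entries : ∀ {n r} → Vec (Fin n) r → Fin r → ℤ
entries x j = ℤ.+ toℕ (lookup x j)

module _ where
  open import Data.Nat.Base using (_+_; _*_; _^_)

  length-filter-map : ∀ {A B : Set} {P : B → Set} (P? : Decidable P) (f : A → B) (xs : List A) →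
                      length (filter P? (map f xs)) ≡ length (filter (P? ∘ f) xs)
  length-filter-map P? f [] = refl
  length-filter-map P? f (x ∷ xs) with P? (f x)
  ... | yes _ = cong suc (length-filter-map P? f xs)
  ... | no _  = length-filter-map P? f xs

  length-filter-concatMap : ∀ {A B : Set} {P : B → Set} (P? : Decidable P) (f : A → List B) (xs : List A) →
                            length (filter P? (concatMap f xs)) ≡ sum (map (λ x → length (filter P? (f x))) xs)
  length-filter-concatMap P? f [] = refl
  length-filter-concatMap P? f (x ∷ xs) = begin
    length (filter P? (f x ++ concatMap f xs))                      ≡⟨ cong length (filter-++ P? (f x) _) ⟩
    length (filter P? (f x) ++ filter P? (concatMap f xs))          ≡⟨ length-++ (filter P? (f x)) ⟩
    length (filter P? (f x)) + length (filter P? (concatMap f xs))  ≡⟨ cong₂ _+_ refl (length-filter-concatMap P? f xs) ⟩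
    length (filter P? (f x)) + sum (map (λ x → length (filter P? (f x))) xs) ∎
    where open ≡-Reasoning

  sum-map-indicator : ∀ {A : Set} {Q : A → Set} (Q? : Decidable Q) {f : A → ℕ} {k : ℕ} →
                      (∀ {a} → Q a → f a ≡ k) → (∀ {a} → ¬ Q a → f a ≡ 0) →
                      ∀ xs → sum (map f xs) ≡ length (filter Q? xs) * k
  sum-map-indicator Q? on off [] = refl
  sum-map-indicator Q? on off (x ∷ xs) with Q? x
  ... | yes q = cong₂ _+_ (on q) (sum-map-indicator Q? on off xs)
  ... | no ¬q = cong₂ _+_ (off ¬q) (sum-map-indicator Q? on off xs)

  module _ {n : ℕ} where

    length-filter-allVecs-suc : ∀ r {R : Vec (Fin n) (suc r) → Set} (R? : Decidable R) →
      length (filter R? (allVecs n (suc r))) ≡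
      sum (map (λ a → length (filter (R? ∘ (a ∷_)) (allVecs n r))) (allFin n))
    length-filter-allVecs-suc r R? =
      trans (length-filter-concatMap R? _ (allFin n))
            (cong sum (map-cong (λ a → length-filter-map R? (a ∷_) (allVecs n r)) (allFin n)))

    length-filter-allVecs-∀ : ∀ r {P : Fin n → Set} (P? : Decidable P)
      {R : Vec (Fin n) r → Set} (R? : Decidable R) → (∀ v → R v ⇔ (∀ i → P (lookup v i))) →
      length (filter R? (allVecs n r)) ≡ length (filter P? (allFin n)) ^ r

    length-filter-allVecs-∷ : ∀ r {Q : Fin n → Set} (Q? : Decidable Q)
      {P : Fin n → Fin n → Set} (P? : ∀ a → Decidable (P a)) {k : ℕ} →
      (∀ a → length (filter (P? a) (allFin n)) ≡ k) →
      {R : Vec (Fin n) (suc r) → Set} (R? : Decidable R) →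
      (∀ a v → R (a ∷ v) ⇔ (Q a × ∀ i → P a (lookup v i))) →
      length (filter R? (allVecs n (suc r))) ≡ length (filter Q? (allFin n)) * k ^ r

    length-filter-allVecs-∀ zero P? R? R⇔ = cong length (filter-accept R? (from (R⇔ []) λ ()))
    length-filter-allVecs-∀ (suc r) {P} P? {R} R? R⇔ =
      length-filter-allVecs-∷ r P? (λ _ → P?) (λ _ → refl) R? R∷⇔
      where
      R∷⇔ : ∀ a v → R (a ∷ v) ⇔ (P a × ∀ i → P (lookup v i))
      R∷⇔ a v = mk⇔ (λ r → let p = to (R⇔ (a ∷ v)) r in p Fin.zero , p ∘ Fin.suc)
                    (λ (pa , pv) → from (R⇔ (a ∷ v)) λ { Fin.zero → pa ; (Fin.suc i) → pv i })

    length-filter-allVecs-∷ r {Q} Q? P? {k} count-P {R} R? R⇔ =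
      trans (length-filter-allVecs-suc r R?) (sum-map-indicator Q? accepted rejected (allFin n))
      where
      accepted : ∀ {a} → Q a → length (filter (R? ∘ (a ∷_)) (allVecs n r)) ≡ k ^ r
      accepted {a} qa = trans
        (length-filter-allVecs-∀ r (P? a) (R? ∘ (a ∷_))
          (λ v → mk⇔ (proj₂ ∘ to (R⇔ a v)) (λ p → from (R⇔ a v) (qa , p))))
        (cong (_^ r) (count-P a))
      rejected : ∀ {a} → ¬ Q a → length (filter (R? ∘ (a ∷_)) (allVecs n r)) ≡ 0
      rejected {a} ¬qa =
        cong length (filter-none (R? ∘ (a ∷_))
                                 (All.universal (λ v → ¬qa ∘ proj₁ ∘ to (R⇔ a v)) (allVecs n r)))

module _ where
  open import Data.Nat.Base using (_+_; _*_)
  open import Data.Nat.DivMod using (m<n⇒m%n≡m; [m+n]%n≡m%n)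
  open ≡-Reasoning

  countBelow : {P : ℕ → Set} → Decidable P → ℕ → ℕ
  countBelow P? zero    = 0
  countBelow P? (suc n) = (if does (P? 0) then 1 else 0) + countBelow (P? ∘ suc) n

  length-filter-tabulate≡countBelow : ∀ {n} {A : Set} {R : A → Set} (R? : Decidable R) (f : Fin n → A)
    {P : ℕ → Set} (P? : Decidable P) → (∀ i → R (f i) ⇔ P (toℕ i)) →
    length (filter R? (tabulate f)) ≡ countBelow P? n
  length-filter-tabulate≡countBelow {zero}  R? f P? R⇔P = refl
  length-filter-tabulate≡countBelow {suc n} R? f P? R⇔P with R? (f Fin.zero) | P? 0
  ... | yes _ | yes _  = cong suc (length-filter-tabulate≡countBelow R? (f ∘ Fin.suc) (P? ∘ suc) (R⇔P ∘ Fin.suc))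
  ... | yes r | no ¬p  = ⊥-elim (¬p (to (R⇔P Fin.zero) r))
  ... | no ¬r | yes p  = ⊥-elim (¬r (from (R⇔P Fin.zero) p))
  ... | no _  | no _   = length-filter-tabulate≡countBelow R? (f ∘ Fin.suc) (P? ∘ suc) (R⇔P ∘ Fin.suc)

  countBelow-cong : ∀ n {P Q : ℕ → Set} (P? : Decidable P) (Q? : Decidable Q) →
                    (∀ b → P b ⇔ Q b) → countBelow P? n ≡ countBelow Q? n
  countBelow-cong n {P} {Q} P? Q? P⇔Q = trans
    (sym (length-filter-tabulate≡countBelow {n} (Q? ∘ toℕ) id P? Q⇔P))
    (length-filter-tabulate≡countBelow {n} (Q? ∘ toℕ) id Q? (λ _ → ⇔-id _))
    where Q⇔P : ∀ i → Q (toℕ i) ⇔ P (toℕ i)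
          Q⇔P i = mk⇔ (from (P⇔Q (toℕ i))) (to (P⇔Q (toℕ i)))

  countBelow-+ : ∀ p q {P : ℕ → Set} (P? : Decidable P) →
                 countBelow P? (p + q) ≡ countBelow P? p + countBelow (P? ∘ (p +_)) q
  countBelow-+ zero    q P? = refl
  countBelow-+ (suc p) q P? =
    trans (cong₂ _+_ refl (countBelow-+ p q (P? ∘ suc))) (sym (ℕₚ.+-assoc (if does (P? 0) then 1 else 0) _ _))

  countBelow-periodic : ∀ g p {P : ℕ → Set} (P? : Decidable P) → (∀ b → P (p + b) ⇔ P b) →
                        countBelow P? (g * p) ≡ g * countBelow P? p
  countBelow-periodic zero    p P? shift = refl
  countBelow-periodic (suc g) p P? shift = begin
    countBelow P? (p + g * p)                          ≡⟨ countBelow-+ p (g * p) P? ⟩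
    countBelow P? p + countBelow (P? ∘ (p +_)) (g * p) ≡⟨ cong₂ _+_ refl (countBelow-cong (g * p) _ P? shift) ⟩
    countBelow P? p + countBelow P? (g * p)            ≡⟨ cong₂ _+_ refl (countBelow-periodic g p P? shift) ⟩
    countBelow P? p + g * countBelow P? p              ∎

  countBelow-none : ∀ n {P : ℕ → Set} (P? : Decidable P) → (∀ {b} → b < n → ¬ P b) → countBelow P? n ≡ 0
  countBelow-none zero    P? none = refl
  countBelow-none (suc n) P? none with P? 0
  ... | yes p = ⊥-elim (none z<s p)
  ... | no _  = countBelow-none n (P? ∘ suc) (none ∘ s≤s)

  countBelow-unique : ∀ {n k} {P : ℕ → Set} (P? : Decidable P) → k < n →
                      (∀ {b} → b < n → P b ⇔ b ≡ k) → countBelow P? n ≡ 1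
  countBelow-unique {suc n} {zero} P? _ P⇔ with P? 0
  ... | yes _ = cong suc (countBelow-none n (P? ∘ suc) (λ b<n → ℕₚ.1+n≢0 ∘ to (P⇔ (s≤s b<n))))
  ... | no ¬p = ⊥-elim (¬p (from (P⇔ z<s) refl))
  countBelow-unique {suc n} {suc k} P? (s≤s k<n) P⇔ with P? 0
  ... | yes p = ⊥-elim (ℕₚ.0≢1+n (to (P⇔ z<s) p))
  ... | no _  = countBelow-unique (P? ∘ suc) k<n
                  (λ b<n → mk⇔ (ℕₚ.suc-injective ∘ to (P⇔ (s≤s b<n))) (from (P⇔ (s≤s b<n)) ∘ cong suc))

  countBelow-%≡ : ∀ g m .{{_ : NonZero m}} {k} → k < m → countBelow (λ b → b % m ℕₚ.≟ k) (g * m) ≡ g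
  countBelow-%≡ g m {k} k<m = begin
    countBelow P? (g * m) ≡⟨ countBelow-periodic g m P? shift ⟩
    g * countBelow P? m   ≡⟨ cong (g *_) (countBelow-unique P? k<m below) ⟩
    g * 1                 ≡⟨ ℕₚ.*-identityʳ g ⟩
    g                     ∎
    where
    P? : Decidable (λ b → b % m ≡ k)
    P? b = b % m ℕₚ.≟ k
    shift : ∀ b → ((m + b) % m ≡ k) ⇔ (b % m ≡ k)
    shift b = mk⇔ (trans (sym shift-%)) (trans shift-%)
      where shift-% : (m + b) % m ≡ b % m
            shift-% = trans (cong (_% m) (ℕₚ.+-comm m b)) ([m+n]%n≡m%n b m)
    below : ∀ {b} → b < m → (b % m ≡ k) ⇔ (b ≡ k)
    below b<m = mk⇔ (trans (sym (m<n⇒m%n≡m b<m))) (trans (m<n⇒m%n≡m b<m))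

  length-filter-allFin-%≡ : ∀ {n} g m .{{_ : NonZero m}} → g * m ≡ n → ∀ {k} → k < m →
    {R : Fin n → Set} (R? : Decidable R) → (∀ i → R i ⇔ (toℕ i % m ≡ k)) →
    length (filter R? (allFin n)) ≡ g
  length-filter-allFin-%≡ g m refl k<m R? R⇔ =
    trans (length-filter-tabulate≡countBelow R? id _ R⇔) (countBelow-%≡ g m k<m)

module _ where
  open import Data.Nat.Base using (_+_; _*_; _∸_)
  open import Data.Nat.DivMod using (m/n*n≡m; m≡m%n+[m/n]*n; %-remove-+ʳ)
  open import Data.Nat.Divisibility using (_∣_; divides; *-cancelʳ-∣; *-pres-∣)
  open import Data.Nat.GCD using (gcd[m,n]∣m; gcd[m,n]∣n; n/gcd[m,n]≢0)
  open import Data.Nat.Coprimality using (coprime-/gcd; coprime-divisor)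
  import Data.Nat.Coprimality as Coprime
  open import Data.Nat.Tactic.RingSolver using (solve-∀)
  open ≡-Reasoning

  n∣m*o⇔n/gcd[m,n]∣o : ∀ m n o .{{_ : NonZero n}} → (n ∣ m * o) ⇔ ((n / gcd m n) {{gcd-nonZero m n}} ∣ o)
  n∣m*o⇔n/gcd[m,n]∣o m n o = mk⇔ cancel scale
    where
    instance _ = gcd-nonZero m n
    g : ℕ
    g = gcd m n
    n′g≡n : n / g * g ≡ n
    n′g≡n = m/n*n≡m (gcd[m,n]∣n m n)
    m′g≡m : m / g * g ≡ m
    m′g≡m = m/n*n≡m (gcd[m,n]∣m m n)
    m*o≡m′*o*g : m * o ≡ m / g * o * g
    m*o≡m′*o*g = trans (cong (_* o) (sym m′g≡m)) (swap (m / g) g o)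
      where swap : ∀ a b c → a * b * c ≡ a * c * b
            swap = solve-∀
    cancel : n ∣ m * o → n / g ∣ o
    cancel n∣m*o = coprime-divisor (Coprime.sym (coprime-/gcd m n))
                     (*-cancelʳ-∣ g (subst₂ _∣_ (sym n′g≡n) m*o≡m′*o*g n∣m*o))
    scale : n / g ∣ o → n ∣ m * o
    scale n′∣o = subst₂ _∣_ n′g≡n (ℕₚ.*-comm o m) (*-pres-∣ n′∣o (divides (m / g) (sym m′g≡m)))

  n/gcd-nonZero : ∀ n .{{_ : NonZero n}} e → NonZero (n /gcd e)
  n/gcd-nonZero n e = ℕ.≢-nonZero (n/gcd[m,n]≢0 ∣ e ∣ n {{gcd≢0 = gcd-nonZero ∣ e ∣ n}})

  n/gcd*gcd≡n : ∀ n .{{_ : NonZero n}} e → n /gcd e * gcd ∣ e ∣ n ≡ n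
  n/gcd*gcd≡n n e = m/n*n≡m {{gcd-nonZero ∣ e ∣ n}} (gcd[m,n]∣n ∣ e ∣ n)

  m∣n∸o⇔n%m≡o%m : ∀ m .{{_ : NonZero m}} {n o} → o ≤ n → (m ∣ n ∸ o) ⇔ (n % m ≡ o % m)
  m∣n∸o⇔n%m≡o%m m {n} {o} o≤n = mk⇔ same-residue divides-difference
    where
    same-residue : m ∣ n ∸ o → n % m ≡ o % m
    same-residue m∣n∸o = trans (cong (_% m) (sym (ℕₚ.m+[n∸m]≡n o≤n))) (%-remove-+ʳ o m∣n∸o)
    divides-difference : n % m ≡ o % m → m ∣ n ∸ o
    divides-difference n%m≡o%m = divides (n / m ∸ o / m) (begin
      n ∸ o                                       ≡⟨ cong₂ _∸_ (m≡m%n+[m/n]*n n m) (m≡m%n+[m/n]*n o m) ⟩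
      (n % m + n / m * m) ∸ (o % m + o / m * m)   ≡⟨ cong (λ z → (z + n / m * m) ∸ (o % m + o / m * m)) n%m≡o%m ⟩
      (o % m + n / m * m) ∸ (o % m + o / m * m)   ≡⟨ ℕₚ.[m+n]∸[m+o]≡n∸o (o % m) _ _ ⟩
      n / m * m ∸ o / m * m                       ≡⟨ ℕₚ.*-distribʳ-∸ m (n / m) (o / m) ⟨
      (n / m ∸ o / m) * m                         ∎)

  ∣a-b∣≡a∸b : ∀ {a b} → b ≤ a → ∣ ℤ.+ a ℤ.- ℤ.+ b ∣ ≡ a ∸ b
  ∣a-b∣≡a∸b {a} {b} b≤a = cong ∣_∣ (trans (ℤₚ.m-n≡m⊖n a b) (ℤₚ.⊖-≥ b≤a))

  m∣∣a-b∣⇔a%m≡b%m : ∀ m .{{_ : NonZero m}} a b → (m ∣ ∣ ℤ.+ a ℤ.- ℤ.+ b ∣) ⇔ (a % m ≡ b % m)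
  m∣∣a-b∣⇔a%m≡b%m m a b with ℕₚ.≤-total b a
  ... | inj₁ b≤a =
    subst (λ z → (m ∣ z) ⇔ (a % m ≡ b % m)) (sym (∣a-b∣≡a∸b b≤a)) (m∣n∸o⇔n%m≡o%m m b≤a)
  ... | inj₂ a≤b = ⇔-trans
    (subst (λ z → (m ∣ z) ⇔ (b % m ≡ a % m))
           (sym (trans (ℤₚ.∣i-j∣≡∣j-i∣ (ℤ.+ a) (ℤ.+ b)) (∣a-b∣≡a∸b a≤b)))
           (m∣n∸o⇔n%m≡o%m m a≤b))
    (mk⇔ sym sym)

module _ where
  open import Data.Integer.Base using (+_; _+_; _*_; _-_)
  open import Data.Integer.Divisibility.Signed
    using (_∣_; _∣?_; divides; ∣ᵤ⇒∣; ∣⇒∣ᵤ; ∣m⇒∣m*n)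
    using (∣m∣n⇒∣m+n; ∣m∣n⇒∣m-n; ∣m+n∣m⇒∣n; ∣m+n∣n⇒∣m)
  import Data.Integer.Divisibility as Unsigned
  import Data.Nat.Divisibility as ℕᵈ
  open import Data.Integer.Tactic.RingSolver using (solve-∀)
  open import Data.Nat.DivMod using (m%n<n)
  open ≡-Reasoning

  ∣ᵤ⇔∣ : ∀ {k i} → k Unsigned.∣ i ⇔ k ∣ i
  ∣ᵤ⇔∣ = mk⇔ ∣ᵤ⇒∣ ∣⇒∣ᵤ

  ∣m+n⇔∣m : ∀ {k m n} → k ∣ n → (k ∣ m + n) ⇔ (k ∣ m)
  ∣m+n⇔∣m k∣n = mk⇔ (λ k∣m+n → ∣m+n∣n⇒∣m k∣m+n k∣n) (λ k∣m → ∣m∣n⇒∣m+n k∣m k∣n)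

  ∣m+n⇔∣n : ∀ {k m n} → k ∣ m → (k ∣ m + n) ⇔ (k ∣ n)
  ∣m+n⇔∣n k∣m = mk⇔ (λ k∣m+n → ∣m+n∣m⇒∣n k∣m+n k∣m) (∣m∣n⇒∣m+n k∣m)

  +n∣e*y⇔n/gcd∣∣y∣ : ∀ n .{{_ : NonZero n}} e y → (+ n ∣ e * y) ⇔ (n /gcd e ℕᵈ.∣ ∣ y ∣)
  +n∣e*y⇔n/gcd∣∣y∣ n e y = ⇔-trans (mk⇔ ∣⇒∣ᵤ ∣ᵤ⇒∣)
    (subst (λ z → (n ℕᵈ.∣ z) ⇔ (n /gcd e ℕᵈ.∣ ∣ y ∣)) (sym (ℤₚ.abs-* e y))
           (n∣m*o⇔n/gcd[m,n]∣o (∣ e ∣) n (∣ y ∣)))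

  ∣-Σℤ : ∀ {r k} {f : Fin r → ℤ} → (∀ j → k ∣ f j) → k ∣ Σℤ f
  ∣-Σℤ {zero}  k∣f = divides (+ 0) refl
  ∣-Σℤ {suc r} k∣f = ∣m∣n⇒∣m+n (k∣f Fin.zero) (∣-Σℤ (k∣f ∘ Fin.suc))

  Σℤ-*ˡ : ∀ {r} d (f : Fin r → ℤ) → Σℤ (λ j → d * f j) ≡ d * Σℤ f
  Σℤ-*ˡ {zero}  d f = sym (ℤₚ.*-zeroʳ d)
  Σℤ-*ˡ {suc r} d f = begin
    d * f Fin.zero + Σℤ (λ j → d * f (Fin.suc j))
      ≡⟨ cong (λ z → d * f Fin.zero + z) (Σℤ-*ˡ d (f ∘ Fin.suc)) ⟩
    d * f Fin.zero + d * Σℤ (f ∘ Fin.suc)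
      ≡⟨ ℤₚ.*-distribˡ-+ d (f Fin.zero) _ ⟨
    d * Σℤ f                                      ∎

  Σℤ-[-a] : ∀ {r} (f : Fin r → ℤ) a → Σℤ (λ j → f j - a) ≡ Σℤ f - + r * a
  Σℤ-[-a] {zero}  f a = refl
  Σℤ-[-a] {suc r} f a = begin
    f Fin.zero - a + Σℤ (λ j → f (Fin.suc j) - a)
      ≡⟨ cong (λ z → f Fin.zero - a + z) (Σℤ-[-a] (f ∘ Fin.suc) a) ⟩
    f Fin.zero - a + (Σℤ (f ∘ Fin.suc) - + r * a)
      ≡⟨ regroup (f Fin.zero) _ a (+ r) ⟩
    Σℤ f - + suc r * a ∎
    where regroup : ∀ x s a k → x - a + (s - k * a) ≡ x + s - (+ 1 + k) * a
          regroup = solve-∀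

  Σℤ-row : ∀ {r} c d (i : Fin r) (f : Fin r → ℤ) → Σℤ (λ j → B c d i j * f j) ≡ c * f i + d * (Σℤ f - f i)
  Σℤ-row {suc r} c d Fin.zero f = begin
    c * f Fin.zero + Σℤ (λ j → d * f (Fin.suc j))
      ≡⟨ cong (λ z → c * f Fin.zero + z) (Σℤ-*ˡ d (f ∘ Fin.suc)) ⟩
    c * f Fin.zero + d * Σℤ (f ∘ Fin.suc)
      ≡⟨ regroup c d (f Fin.zero) _ ⟩
    c * f Fin.zero + d * (Σℤ f - f Fin.zero) ∎
    where regroup : ∀ c d x s → c * x + d * s ≡ c * x + d * ((x + s) - x)
          regroup = solve-∀
  Σℤ-row {suc r} c d (Fin.suc i) f = begin
    d * f Fin.zero + Σℤ (λ j → B c d i j * f (Fin.suc j))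
      ≡⟨ cong (λ z → d * f Fin.zero + z) (Σℤ-row c d i (f ∘ Fin.suc)) ⟩
    d * f Fin.zero + (c * f (Fin.suc i) + d * (Σℤ (f ∘ Fin.suc) - f (Fin.suc i)))
      ≡⟨ regroup c d (f Fin.zero) (f (Fin.suc i)) _ ⟩
    c * f (Fin.suc i) + d * (Σℤ f - f (Fin.suc i)) ∎
    where regroup : ∀ c d x y s → d * x + (c * y + d * (s - y)) ≡ c * y + d * ((x + s) - y)
          regroup = solve-∀

  ∀∣d*[Σℤ-x]⇔ : ∀ {m} k d (x : Fin (suc m) → ℤ) →
    (∀ i → k ∣ d * (Σℤ x - x i)) ⇔ (k ∣ (+ m * d) * x Fin.zero × ∀ j → k ∣ d * (x (Fin.suc j) - x Fin.zero))
  ∀∣d*[Σℤ-x]⇔ {m} k d x = mk⇔ forward backward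
    where
    x₀ : ℤ
    x₀ = x Fin.zero
    y : Fin (suc m) → ℤ
    y i = d * (Σℤ x - x i)
    δ : Fin m → ℤ
    δ j = d * (x (Fin.suc j) - x₀)
    y₀≡Σδ+mdx₀ : y Fin.zero ≡ Σℤ δ + (+ m * d) * x₀
    y₀≡Σδ+mdx₀ = begin
      d * ((x₀ + Σℤ (x ∘ Fin.suc)) - x₀)            ≡⟨ regroup d x₀ _ (+ m) ⟩
      d * (Σℤ (x ∘ Fin.suc) - + m * x₀) + (+ m * d) * x₀ ≡⟨ cong (λ z → z + (+ m * d) * x₀) Σδ ⟨
      Σℤ δ + (+ m * d) * x₀                          ∎
      where
      regroup : ∀ d a s m → d * ((a + s) - a) ≡ d * (s - m * a) + (m * d) * a
      regroup = solve-∀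
      Σδ : Σℤ δ ≡ d * (Σℤ (x ∘ Fin.suc) - + m * x₀)
      Σδ = trans (Σℤ-*ˡ d (λ j → x (Fin.suc j) - x₀)) (cong (d *_) (Σℤ-[-a] (x ∘ Fin.suc) x₀))
    δ≡y₀-y : ∀ j → δ j ≡ y Fin.zero - y (Fin.suc j)
    δ≡y₀-y j = regroup d (Σℤ x) x₀ (x (Fin.suc j))
      where regroup : ∀ d s a b → d * (b - a) ≡ d * (s - a) - d * (s - b)
            regroup = solve-∀
    y≡y₀-δ : ∀ j → y (Fin.suc j) ≡ y Fin.zero - δ j
    y≡y₀-δ j = regroup d (Σℤ x) x₀ (x (Fin.suc j))
      where regroup : ∀ d s a b → d * (s - b) ≡ d * (s - a) - d * (b - a)
            regroup = solve-∀
    forward : (∀ i → k ∣ y i) → k ∣ (+ m * d) * x₀ × ∀ j → k ∣ δ j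
    forward k∣y = ∣m+n∣m⇒∣n (subst (k ∣_) y₀≡Σδ+mdx₀ (k∣y Fin.zero)) (∣-Σℤ k∣δ) , k∣δ
      where k∣δ : ∀ j → k ∣ δ j
            k∣δ j = subst (k ∣_) (sym (δ≡y₀-y j)) (∣m∣n⇒∣m-n (k∣y Fin.zero) (k∣y (Fin.suc j)))
    backward : k ∣ (+ m * d) * x₀ × (∀ j → k ∣ δ j) → ∀ i → k ∣ y i
    backward (k∣mdx₀ , k∣δ) Fin.zero    =
      subst (k ∣_) (sym y₀≡Σδ+mdx₀) (∣m∣n⇒∣m+n (∣-Σℤ k∣δ) k∣mdx₀)
    backward (k∣mdx₀ , k∣δ) (Fin.suc j) =
      subst (k ∣_) (sym (y≡y₀-δ j)) (∣m∣n⇒∣m-n (backward (k∣mdx₀ , k∣δ) Fin.zero) (k∣δ j))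

  InΛ⇔rows : ∀ n c d {r} (x : Vec (Fin n) r) →
    InΛ n c d x ⇔ (∀ i → + n ∣ c * entries x i + d * (Σℤ (entries x) - entries x i))
  InΛ⇔rows n c d x =
    ∀-⇔ λ i → subst (λ z → (+ n Unsigned.∣ Bx c d x i) ⇔ (+ n ∣ z)) (Σℤ-row c d i (entries x)) ∣ᵤ⇔∣

  InΛ⇔-∣d : ∀ n c d {r} (x : Vec (Fin n) r) → + n ∣ d → InΛ n c d x ⇔ (∀ i → + n ∣ c * entries x i)
  InΛ⇔-∣d n c d x n∣d = ⇔-trans (InΛ⇔rows n c d x) (∀-⇔ λ i → ∣m+n⇔∣m (∣m⇒∣m*n _ n∣d))

  InΛ⇔-∣c : ∀ n c d {m} (a : Fin n) (v : Vec (Fin n) m) → + n ∣ c →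
    InΛ n c d (a ∷ v) ⇔ (+ n ∣ (+ m * d) * + toℕ a × ∀ j → + n ∣ d * (entries v j - + toℕ a))
  InΛ⇔-∣c n c d a v n∣c = ⇔-trans (InΛ⇔rows n c d (a ∷ v))
    (⇔-trans (∀-⇔ λ i → ∣m+n⇔∣n (∣m⇒∣m*n _ n∣c)) (∀∣d*[Σℤ-x]⇔ (+ n) d (entries (a ∷ v))))

  length-filter-solutions : ∀ n .{{_ : NonZero n}} e a {R : Fin n → Set} (R? : Decidable R) →
    (∀ i → R i ⇔ (+ n ∣ e * (+ toℕ i - + a))) → length (filter R? (allFin n)) ≡ gcd ∣ e ∣ n
  length-filter-solutions n e a {R} R? R⇔ =
    length-filter-allFin-%≡ (gcd ∣ e ∣ n) (n /gcd e) g*n′≡n (m%n<n a (n /gcd e)) R? R⇔residue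
    where
    instance _ = n/gcd-nonZero n e
    g*n′≡n : gcd ∣ e ∣ n ℕ.* (n /gcd e) ≡ n
    g*n′≡n = trans (ℕₚ.*-comm (gcd ∣ e ∣ n) (n /gcd e)) (n/gcd*gcd≡n n e)
    R⇔residue : ∀ i → R i ⇔ (toℕ i % (n /gcd e) ≡ a % (n /gcd e))
    R⇔residue i = ⇔-trans (R⇔ i)
      (⇔-trans (+n∣e*y⇔n/gcd∣∣y∣ n e _) (m∣∣a-b∣⇔a%m≡b%m (n /gcd e) (toℕ i) a))

  length-filter-solutions₀ : ∀ n .{{_ : NonZero n}} e {R : Fin n → Set} (R? : Decidable R) →
    (∀ i → R i ⇔ (+ n ∣ e * + toℕ i)) → length (filter R? (allFin n)) ≡ gcd ∣ e ∣ n
  length-filter-solutions₀ n e {R} R? R⇔ = length-filter-solutions n e 0 R?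
    (λ i → subst (λ z → R i ⇔ (+ n ∣ e * z)) (sym (ℤₚ.+-identityʳ (+ toℕ i))) (R⇔ i))

  cardΛ-∣d : ∀ n .{{_ : NonZero n}} r c d → + n Unsigned.∣ d → cardΛ n r c d ≡ gcd ∣ c ∣ n ℕ.^ r
  cardΛ-∣d n r c d n∣d =
    trans (length-filter-allVecs-∀ r P? (InΛ? n c d) (λ x → InΛ⇔-∣d n c d x (∣ᵤ⇒∣ n∣d)))
          (cong (ℕ._^ r) (length-filter-solutions₀ n c P? (λ _ → ⇔-id _)))
    where P? : Decidable (λ (b : Fin n) → + n ∣ c * + toℕ b)
          P? b = + n ∣? c * + toℕ b

  cardΛ-∣c : ∀ n .{{_ : NonZero n}} m c d → + n Unsigned.∣ c →
             cardΛ n (suc m) c d ≡ gcd (∣ + m * d ∣) n ℕ.* gcd (∣ d ∣) n ℕ.^ m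
  cardΛ-∣c n m c d n∣c =
    trans (length-filter-allVecs-∷ m Q? P? (λ a → length-filter-solutions n d (toℕ a) (P? a) (λ _ → ⇔-id _))
                                   (InΛ? n c d) (λ a v → InΛ⇔-∣c n c d a v (∣ᵤ⇒∣ n∣c)))
          (cong (ℕ._* gcd (∣ d ∣) n ℕ.^ m) (length-filter-solutions₀ n (+ m * d) Q? (λ _ → ⇔-id _)))
    where Q? : Decidable (λ (a : Fin n) → + n ∣ (+ m * d) * + toℕ a)
          Q? a = + n ∣? (+ m * d) * + toℕ a
          P? : ∀ a → Decidable (λ (b : Fin n) → + n ∣ d * (+ toℕ b - + toℕ a))
          P? a b = + n ∣? d * (+ toℕ b - + toℕ a)

open import Data.Nat.Base using (_^_; _*_; _∸_)
open import Data.Nat.DivMod using (m*n/n≡m; /-congˡ)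
open import Data.Integer.Base using (+_)
open import Data.Integer.Divisibility using (_∣_)
open ≡-Reasoning

^-distribʳ-* : ∀ a b k → (a * b) ^ k ≡ a ^ k * b ^ k
^-distribʳ-* a b zero    = refl
^-distribʳ-* a b (suc k) =
  trans (cong ((a * b) *_) (^-distribʳ-* a b k)) (ℕₚ.[m*n]*[o*p]≡[m*o]*[n*p] a b (a ^ k) (b ^ k))

Dim≡ : ∀ n .{{_ : NonZero n}} r c d {q} → n ^ r ≡ q * cardΛ n r c d → Dim n r c d ≡ q
Dim≡ n r c d {q} n^r≡q*card = trans (/-congˡ {o = cardΛ n r c d} n^r≡q*card) (m*n/n≡m q (cardΛ n r c d))
  where instance _ = cardΛ-nonZero n r c d

Dim-∣d : ∀ n .{{_ : NonZero n}} r c d → + n ∣ d → Dim n r c d ≡ (n /gcd c) ^ r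
Dim-∣d n r c d n∣d = Dim≡ n r c d (begin
  n ^ r                                 ≡⟨ cong (_^ r) (n/gcd*gcd≡n n c) ⟨
  (n /gcd c * gcd ∣ c ∣ n) ^ r          ≡⟨ ^-distribʳ-* (n /gcd c) _ r ⟩
  (n /gcd c) ^ r * gcd ∣ c ∣ n ^ r      ≡⟨ cong ((n /gcd c) ^ r *_) (cardΛ-∣d n r c d n∣d) ⟨
  (n /gcd c) ^ r * cardΛ n r c d        ∎)

Dim-∣c : ∀ n .{{_ : NonZero n}} m c d → + n ∣ c →
         Dim n (suc m) c d ≡ (n /gcd d) ^ m * (n /gcd (+ m ℤ.* d))
Dim-∣c n m c d n∣c = Dim≡ n (suc m) c d (begin
  n * n ^ m                                   ≡⟨ cong₂ (λ a b → a * b ^ m) (n/gcd*gcd≡n n e) (n/gcd*gcd≡n n d) ⟨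
  (n /gcd e * g e) * (n /gcd d * g d) ^ m     ≡⟨ cong ((n /gcd e * g e) *_) (^-distribʳ-* (n /gcd d) (g d) m) ⟩
  (n /gcd e * g e) * ((n /gcd d) ^ m * g d ^ m) ≡⟨ regroup (n /gcd e) (g e) ((n /gcd d) ^ m) (g d ^ m) ⟩
  ((n /gcd d) ^ m * (n /gcd e)) * (g e * g d ^ m) ≡⟨ cong ((n /gcd d) ^ m * (n /gcd e) *_) (cardΛ-∣c n m c d n∣c) ⟨
  ((n /gcd d) ^ m * (n /gcd e)) * cardΛ n (suc m) c d ∎)
  where
  e : ℤ
  e = + m ℤ.* d
  g : ℤ → ℕ
  g a = gcd ∣ a ∣ n
  regroup : ∀ a b x y → a * b * (x * y) ≡ x * a * (b * y)
  regroup a b x y = trans (ℕₚ.[m*n]*[o*p]≡[m*o]*[n*p] a b x y) (cong (_* (b * y)) (ℕₚ.*-comm a x))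

corollary7p1 : (r n : ℕ) .{{_ : NonZero n}} → 1 ≤ r → (c d : ℤ) →
    ((+ n ∣ d → Dim n r c d ≡ (n /gcd c) ^ r)
    × (+ n ∣ c → Dim n r c d ≡ (n /gcd d) ^ (r ∸ 1) * (n /gcd (+ (r ∸ 1) ℤ.* d))))
corollary7p1 (suc m) n (s≤s z≤n) c d = Dim-∣d n (suc m) c d , Dim-∣c n m c d
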